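{- Let $G$ be a 3-uniform hypergraph with vertex set $V$, let $(A,B,C)$ be a semi-optimal partition of $V$, and let $(A',B',C')$ be a partition of $V$ with $A'\subseteq A$, $B'\subseteq B$ and $C'\supseteq C$. Then $(A',B',C')$ is also semi-optimal.
   Context: A 3-uniform hypergraph has a finite vertex set $V$ and edges that are distinct 3-element subsets of $V$. For $X\subseteq V$, $d(X)$ is the number of edges meeting $X$. For a partition $(A,B,C)$ of $V$ (an ordered triple of pairwise disjoint sets with union $V$), its degree is $d(A,B,C)=d(A)+d(B)+d(C)$. The partition $(A,B,C)$ is semi-optimal if its degree cannot be increased by moving a single vertex into $C$, i.e. $d(A,B,C)\ge d(A\setminus\{v\},B,C\cup\{v\})$ for every $v\in A$ and $d(A,B,C)\ge d(A,B\setminus\{v\},C\cup\{v\})$ for every $v\in B$. -}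

module Defs where

open import Data.Nat using (ℕ; _+_; _≥_)
open import Data.Fin using (Fin)
open import Data.Fin.Subset using (Subset; Nonempty; _∩_; _∪_; _∈_; _⊆_; ∣_∣; ⁅_⁆; _-_; ⊥; ⊤)
open import Data.Fin.Subset.Properties using (nonempty?)
open import Data.List using (List; length; filter)
open import Data.List.Relation.Unary.All using (All)
open import Data.List.Relation.Unary.Unique.Propositional using (Unique)
open import Data.Product using (_×_)
open import Relation.Binary.PropositionalEquality using (_≡_)

record Hypergraph3 (n : ℕ) : Set where
  field
    edges    : List (Subset n)
    uniform  : All (λ e → ∣ e ∣ ≡ 3) edges
    distinct : Unique edges
open Hypergraph3 public

d : ∀ {n} → Hypergraph3 n → Subset n → ℕ
d G X = length (filter (λ e → nonempty? (e ∩ X)) (edges G))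

deg : ∀ {n} → Hypergraph3 n → Subset n → Subset n → Subset n → ℕ
deg G A B C = d G A + d G B + d G C

IsPartition : ∀ {n} → Subset n → Subset n → Subset n → Set
IsPartition A B C =
  (A ∩ B ≡ ⊥) × (A ∩ C ≡ ⊥) × (B ∩ C ≡ ⊥) × (A ∪ B ∪ C ≡ ⊤)

SemiOptimal : ∀ {n} → Hypergraph3 n → Subset n → Subset n → Subset n → Set
SemiOptimal {n} G A B C =
  IsPartition A B C ×
  (∀ (v : Fin n) → v ∈ A → deg G A B C ≥ deg G (A - v) B (C ∪ ⁅ v ⁆)) ×
  (∀ (v : Fin n) → v ∈ B → deg G A B C ≥ deg G A (B - v) (C ∪ ⁅ v ⁆))

-- Edge counting X ↦ d X is a coverage function, hence monotone and submodular.
-- Moving v ∈ A into C changes d A + d C (the third part is untouched), by the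
-- loss d A − d (A − v) and the gain d (C ∪ {v}) − d C.  Submodularity says the
-- loss can only grow when A shrinks to A′ and the gain can only shrink when C
-- grows to C′, so a move that did not pay off for (A, B, C) does not pay off
-- for (A′, B′, C′) either; likewise for B.
module Submission where

open import Defs
open import Data.Nat using (ℕ; _+_; _≤_; z≤n; s≤s)
open import Data.Nat.Properties
  using (+-assoc; +-comm; +-mono-≤; +-monoʳ-≤; +-cancelˡ-≤; +-cancelʳ-≤; ≤-refl; +-commutativeSemigroup; module ≤-Reasoning)
open import Data.Nat.Tactic.RingSolver using (solve-∀)
open import Algebra.Properties.CommutativeSemigroup +-commutativeSemigroup using (interchange)
open import Data.Fin using (Fin; _≟_)
open import Data.Fin.Subset using (Subset; Nonempty; _⊆_; _∈_; _∉_; _∩_; _∪_; _─_; _-_; ⁅_⁆; inside; outside)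
open import Data.Fin.Subset.Properties
  using (x∈p∩q⁺; x∈p∩q⁻; x∈p∪q⁺; x∈p∪q⁻; p⊆p∪q; q⊆p∪q; p∩q⊆p; p∩q⊆q; p─q⊆p; x∈p∧x∉q⇒x∈p─q; x∈p∧x≢y⇒x∈p-y)
open import Data.Vec using (_∷_; here; there)
open import Data.List using (List; []; _∷_; length; filter)
open import Data.Product using (_×_; _,_; proj₁; proj₂)
open import Data.Sum using (_⊎_; inj₁; inj₂; [_,_])
open import Data.Empty using (⊥-elim)
open import Function using (_∘′_)
open import Function.Bundles using (_⇔_; mk⇔; Equivalence)
open import Relation.Nullary using (Dec; yes; no)
open import Relation.Unary using (Pred; Decidable)
open import Relation.Binary.PropositionalEquality using (_≡_; refl; cong; cong₂; subst₂; sym)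

private
  variable
    n : ℕ

x∈p─q⇒x∉q : ∀ (p q : Subset n) {x} → x ∈ p ─ q → x ∉ q
x∈p─q⇒x∉q (inside ∷ p) (outside ∷ q) here        ()
x∈p─q⇒x∉q (_      ∷ p) (_       ∷ q) (there x∈) (there x∈q) = x∈p─q⇒x∉q p q x∈ x∈q

p⊆q⇒p─r⊆q─r : ∀ {p q : Subset n} (r : Subset n) → p ⊆ q → p ─ r ⊆ q ─ r
p⊆q⇒p─r⊆q─r {p = p} r p⊆q x∈p─r =
  x∈p∧x∉q⇒x∈p─q (p⊆q (p─q⊆p p r x∈p─r)) (x∈p─q⇒x∉q p r x∈p─r)

Nonempty-∩-monoʳ : ∀ (p : Subset n) {q r} → q ⊆ r → Nonempty (p ∩ q) → Nonempty (p ∩ r)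
Nonempty-∩-monoʳ p {q} q⊆r (x , x∈p∩q) with x∈p∩q⁻ p q x∈p∩q
... | x∈p , x∈q = x , x∈p∩q⁺ (x∈p , q⊆r x∈q)

Nonempty-∩-∪⁻ : ∀ (p q r : Subset n) → Nonempty (p ∩ (q ∪ r)) → Nonempty (p ∩ q) ⊎ Nonempty (p ∩ r)
Nonempty-∩-∪⁻ p q r (x , x∈) with x∈p∩q⁻ p (q ∪ r) x∈
... | x∈p , x∈q∪r with x∈p∪q⁻ q r x∈q∪r
...   | inj₁ x∈q = inj₁ (x , x∈p∩q⁺ (x∈p , x∈q))
...   | inj₂ x∈r = inj₂ (x , x∈p∩q⁺ (x∈p , x∈r))

indicator : ∀ {a} {A : Set a} → Dec A → ℕ
indicator (yes _) = 1
indicator (no _)  = 0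

indicator-submodular : ∀ {a} {P Q R S : Set a}
  (P? : Dec P) (Q? : Dec Q) (R? : Dec R) (S? : Dec S) →
  (P → R ⊎ S) → (Q → R × S) →
  indicator P? + indicator Q? ≤ indicator R? + indicator S?
indicator-submodular (yes _) (yes _) (yes _) (yes _) _    _    = ≤-refl
indicator-submodular (no _)  (yes _) (yes _) (yes _) _    _    = s≤s z≤n
indicator-submodular _       (yes q) (no ¬r) _       _    Q⇒RS = ⊥-elim (¬r (proj₁ (Q⇒RS q)))
indicator-submodular _       (yes q) (yes _) (no ¬s) _    Q⇒RS = ⊥-elim (¬s (proj₂ (Q⇒RS q)))
indicator-submodular (no _)  (no _)  _       _       _    _    = z≤n
indicator-submodular (yes _) (no _)  (yes _) _       _    _    = s≤s z≤n
indicator-submodular (yes _) (no _)  (no _)  (yes _) _    _    = ≤-refl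
indicator-submodular (yes p) (no _)  (no ¬r) (no ¬s) P⇒RS _    = ⊥-elim ([ ¬r , ¬s ] (P⇒RS p))

length-filter-∷ : ∀ {a p} {A : Set a} {P : Pred A p} (P? : Decidable P) x xs →
  length (filter P? (x ∷ xs)) ≡ indicator (P? x) + length (filter P? xs)
length-filter-∷ P? x xs with P? x
... | yes _ = refl
... | no _  = refl

length-filter-submodular : ∀ {a p} {A : Set a} {P Q R S : Pred A p}
  (P? : Decidable P) (Q? : Decidable Q) (R? : Decidable R) (S? : Decidable S) →
  (∀ {x} → P x → R x ⊎ S x) → (∀ {x} → Q x → R x × S x) → ∀ xs →
  length (filter P? xs) + length (filter Q? xs) ≤ length (filter R? xs) + length (filter S? xs)
length-filter-submodular P? Q? R? S? P⇒RS Q⇒RS [] = z≤n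
length-filter-submodular P? Q? R? S? P⇒RS Q⇒RS (x ∷ xs) = begin
  ∣ P? ∣ (x ∷ xs) + ∣ Q? ∣ (x ∷ xs)
    ≡⟨ cong₂ _+_ (length-filter-∷ P? x xs) (length-filter-∷ Q? x xs) ⟩
  (indicator (P? x) + ∣ P? ∣ xs) + (indicator (Q? x) + ∣ Q? ∣ xs)
    ≡⟨ interchange (indicator (P? x)) _ _ _ ⟩
  (indicator (P? x) + indicator (Q? x)) + (∣ P? ∣ xs + ∣ Q? ∣ xs)
    ≤⟨ +-mono-≤ (indicator-submodular (P? x) (Q? x) (R? x) (S? x) P⇒RS Q⇒RS)
                (length-filter-submodular P? Q? R? S? P⇒RS Q⇒RS xs) ⟩
  (indicator (R? x) + indicator (S? x)) + (∣ R? ∣ xs + ∣ S? ∣ xs)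
    ≡⟨ interchange (indicator (R? x)) _ _ _ ⟩
  (indicator (R? x) + ∣ R? ∣ xs) + (indicator (S? x) + ∣ S? ∣ xs)
    ≡⟨ cong₂ _+_ (length-filter-∷ R? x xs) (length-filter-∷ S? x xs) ⟨
  ∣ R? ∣ (x ∷ xs) + ∣ S? ∣ (x ∷ xs) ∎
  where
  open ≤-Reasoning
  ∣_∣ : ∀ {T : Pred _ _} → Decidable T → List _ → ℕ
  ∣ T? ∣ ys = length (filter T? ys)

-- Monotonicity and submodularity of d in one statement.
d-submodular : ∀ (G : Hypergraph3 n) {U I X Y : Subset n} →
  U ⊆ X ∪ Y → I ⊆ X ∩ Y → d G U + d G I ≤ d G X + d G Y
d-submodular G {U} {I} {X} {Y} U⊆X∪Y I⊆X∩Y =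
  length-filter-submodular _ _ _ _
    (λ {e} → Nonempty-∩-∪⁻ e X Y ∘′ Nonempty-∩-monoʳ e U⊆X∪Y)
    (λ {e} meetsI → Nonempty-∩-monoʳ e (λ x∈I → p∩q⊆p X Y (I⊆X∩Y x∈I)) meetsI
                  , Nonempty-∩-monoʳ e (λ x∈I → p∩q⊆q X Y (I⊆X∩Y x∈I)) meetsI)
    (edges G)

UnprofitableMove : Hypergraph3 n → Subset n → Subset n → Fin n → Set
UnprofitableMove G X C v = d G (X - v) + d G (C ∪ ⁅ v ⁆) ≤ d G X + d G C

p⊆q∪[p-x] : ∀ {p q : Subset n} {x} → x ∈ q → p ⊆ q ∪ (p - x)
p⊆q∪[p-x] {x = x} x∈q {y} y∈p with y ≟ x
... | yes refl = x∈p∪q⁺ (inj₁ x∈q)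
... | no y≢x   = x∈p∪q⁺ (inj₂ (x∈p∧x≢y⇒x∈p-y y∈p y≢x))

UnprofitableMove-mono : ∀ (G : Hypergraph3 n) {X X′ C C′ : Subset n} {v} →
  X′ ⊆ X → C ⊆ C′ → v ∈ X′ → UnprofitableMove G X C v → UnprofitableMove G X′ C′ v
UnprofitableMove-mono G {X} {X′} {C} {C′} {v} X′⊆X C⊆C′ v∈X′ unprofitable =
  +-cancelʳ-≤ (d G X + d G C) _ _ (begin
    d G (X′ - v) + d G (C′ ∪ ⁅ v ⁆) + (d G X + d G C)
      ≡⟨ shuffleˡ (d G (X′ - v)) (d G (C′ ∪ ⁅ v ⁆)) (d G X) (d G C) ⟩
    (d G X + d G (X′ - v)) + (d G (C′ ∪ ⁅ v ⁆) + d G C)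
      ≤⟨ +-mono-≤ loss-grows gain-shrinks ⟩
    (d G X′ + d G (X - v)) + (d G (C ∪ ⁅ v ⁆) + d G C′)
      ≡⟨ shuffleʳ (d G X′) (d G (X - v)) (d G (C ∪ ⁅ v ⁆)) (d G C′) ⟩
    d G X′ + d G C′ + (d G (X - v) + d G (C ∪ ⁅ v ⁆))
      ≤⟨ +-monoʳ-≤ (d G X′ + d G C′) unprofitable ⟩
    d G X′ + d G C′ + (d G X + d G C) ∎)
  where
  open ≤-Reasoning

  loss-grows : d G X + d G (X′ - v) ≤ d G X′ + d G (X - v)
  loss-grows = d-submodular G (p⊆q∪[p-x] v∈X′)
    (λ y∈ → x∈p∩q⁺ (p─q⊆p X′ ⁅ v ⁆ y∈ , p⊆q⇒p─r⊆q─r ⁅ v ⁆ X′⊆X y∈))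

  gain-shrinks : d G (C′ ∪ ⁅ v ⁆) + d G C ≤ d G (C ∪ ⁅ v ⁆) + d G C′
  gain-shrinks = d-submodular G
    (λ y∈ → x∈p∪q⁺ ([ inj₂ , inj₁ ∘′ q⊆p∪q C ⁅ v ⁆ ] (x∈p∪q⁻ C′ ⁅ v ⁆ y∈)))
    (λ y∈C → x∈p∩q⁺ (p⊆p∪q ⁅ v ⁆ y∈C , C⊆C′ y∈C))

  shuffleˡ : ∀ a b c e → a + b + (c + e) ≡ (c + a) + (b + e)
  shuffleˡ = solve-∀

  shuffleʳ : ∀ a b c e → (a + b) + (c + e) ≡ a + e + (b + c)
  shuffleʳ = solve-∀

+-cancel-first-≤⇔ : ∀ a b c b′ c′ → a + b′ + c′ ≤ a + b + c ⇔ b′ + c′ ≤ b + c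
+-cancel-first-≤⇔ a b c b′ c′ = mk⇔
  (λ le → +-cancelˡ-≤ a _ _ (subst₂ _≤_ (+-assoc a b′ c′) (+-assoc a b c) le))
  (λ le → subst₂ _≤_ (sym (+-assoc a b′ c′)) (sym (+-assoc a b c)) (+-monoʳ-≤ a le))

+-cancel-middle-≤⇔ : ∀ a b c a′ c′ → a′ + b + c′ ≤ a + b + c ⇔ a′ + c′ ≤ a + c
+-cancel-middle-≤⇔ a b c a′ c′ =
  subst₂ (λ l r → l ≤ r ⇔ a′ + c′ ≤ a + c) (swap₁₂ a′ c′) (swap₁₂ a c) (+-cancel-first-≤⇔ b a c a′ c′)
  where
  swap₁₂ : ∀ x y → b + x + y ≡ x + b + y
  swap₁₂ x y = cong (_+ y) (+-comm b x)

deg-move₁-≤⇔ : ∀ (G : Hypergraph3 n) X Y C v →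
  deg G (X - v) Y (C ∪ ⁅ v ⁆) ≤ deg G X Y C ⇔ UnprofitableMove G X C v
deg-move₁-≤⇔ G X Y C v =
  +-cancel-middle-≤⇔ (d G X) (d G Y) (d G C) (d G (X - v)) (d G (C ∪ ⁅ v ⁆))

deg-move₂-≤⇔ : ∀ (G : Hypergraph3 n) X Y C v →
  deg G Y (X - v) (C ∪ ⁅ v ⁆) ≤ deg G Y X C ⇔ UnprofitableMove G X C v
deg-move₂-≤⇔ G X Y C v =
  +-cancel-first-≤⇔ (d G Y) (d G X) (d G C) (d G (X - v)) (d G (C ∪ ⁅ v ⁆))

lemma2 : ∀ {n : ℕ} (G : Hypergraph3 n) (A B C A′ B′ C′ : Subset n) →
    SemiOptimal G A B C →
    IsPartition A′ B′ C′ →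
    A′ ⊆ A → B′ ⊆ B → C ⊆ C′ →
    SemiOptimal G A′ B′ C′
lemma2 G A B C A′ B′ C′ (_ , optimalA , optimalB) partition′ A′⊆A B′⊆B C⊆C′ =
  partition′ , optimalA′ , optimalB′
  where
  optimalA′ : ∀ v → v ∈ A′ → deg G (A′ - v) B′ (C′ ∪ ⁅ v ⁆) ≤ deg G A′ B′ C′
  optimalA′ v v∈A′ = Equivalence.from (deg-move₁-≤⇔ G A′ B′ C′ v)
    (UnprofitableMove-mono G A′⊆A C⊆C′ v∈A′
      (Equivalence.to (deg-move₁-≤⇔ G A B C v) (optimalA v (A′⊆A v∈A′))))

  optimalB′ : ∀ v → v ∈ B′ → deg G A′ (B′ - v) (C′ ∪ ⁅ v ⁆) ≤ deg G A′ B′ C′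
  optimalB′ v v∈B′ = Equivalence.from (deg-move₂-≤⇔ G B′ A′ C′ v)
    (UnprofitableMove-mono G B′⊆B C⊆C′ v∈B′
      (Equivalence.to (deg-move₂-≤⇔ G B A C v) (optimalB v (B′⊆B v∈B′))))
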